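{- Let $\ell \in \mathbb{Z}^+$, $m \in \mathbb{Z}^*$ with $m < \ell$, and $\beta \in (0,\tfrac12]$. Define $$\Gamma(\ell,m,\beta) = \min_{n_i\in\mathbb{Z}^*,\, n_d\in\mathbb{Z}^*}\left\{ n_i + n_d \;\Big|\; \frac{m+n_i}{\ell+n_i-n_d} > \beta \right\},$$ where the minimum ranges over pairs with $\ell+n_i-n_d>0$. If $\ell \ge 2m+1$, then $\Gamma(\ell,m,\beta) \ge \dfrac{\beta\ell - m}{1-\beta}$.
   Context: $\mathbb{Z}^+$ denotes the positive integers and $\mathbb{Z}^* = \mathbb{Z}^+\cup\{0\}$. (Interpretation: in a collection of $\ell$ points of which $m$ have a given colour, $n_i$ points of that colour are inserted and $n_d$ points are deleted; $\Gamma$ is the minimum number of such updates after which the colour makes up more than a $\beta$ fraction of the points.)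
   Formalization: The parameter β ranges only over the rational numbers in $(0,\tfrac12]$. -}

module Defs where

open import Data.Nat as ℕ using (ℕ)
open import Data.Integer as ℤ using (ℤ; +_)
open import Data.Rational as ℚ using (ℚ; _/_)
open import Data.Product using (Σ; _×_; ∃₂)
open import Relation.Binary.PropositionalEquality using (_≡_)

ℕtoℚ : ℕ → ℚ
ℕtoℚ n = + n / 1

ℤtoℚ : ℤ → ℚ
ℤtoℚ z = z / 1

newSize : ℕ → ℕ → ℕ → ℤ
newSize ℓ ni nd = (+ ℓ ℤ.+ + ni) ℤ.- + nd

-- Since the denominator is positive, the fraction inequality is written
-- as β · (ℓ + n_i - n_d) < m + n_i.
Feasible : ℕ → ℕ → ℚ → ℕ → ℕ → Set
Feasible ℓ m β ni nd =
  (+ 0 ℤ.< newSize ℓ ni nd) × (β ℚ.* ℤtoℚ (newSize ℓ ni nd) ℚ.< ℕtoℚ (m ℕ.+ ni))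

IsGamma : ℕ → ℕ → ℚ → ℕ → Set
IsGamma ℓ m β g =
  (∃₂ λ ni nd → Feasible ℓ m β ni nd × (ni ℕ.+ nd ≡ g))
  × (∀ ni nd → Feasible ℓ m β ni nd → g ℕ.≤ ni ℕ.+ nd)

{-# OPTIONS --safe #-}
module Submission where

open import Defs
open import Data.Nat as ℕ using (ℕ)
open import Data.Integer as ℤ using (ℤ; +_; -[1+_])
import Data.Integer.Properties as ℤ
open import Data.Rational as ℚ using (ℚ; ½; 0ℚ; 1ℚ)
open import Data.Rational.Literals using (fromℤ)
open import Data.Rational.Properties
open import Data.Rational.Solver using (module +-*-Solver)
open import Data.Product using (_,_)
open import Relation.Binary.PropositionalEquality

-- Only the attainment half of IsGamma and β ≤ ½ are needed: for every feasible pair,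
--   (1 - β)(nᵢ + n_d) = (βℓ - m) + (m + nᵢ - β(ℓ + nᵢ - n_d)) + (1 - 2β) n_d,
-- and the last two summands are non-negative.

ℤtoℚ≡fromℤ : ∀ z → ℤtoℚ z ≡ fromℤ z
ℤtoℚ≡fromℤ z = ↥p/↧p≡p (fromℤ z)

-- fromℤ a + fromℤ b computes to (a * 1 + b * 1) / (1 * 1).
ℤtoℚ-homo-+ : ∀ a b → ℤtoℚ (a ℤ.+ b) ≡ ℤtoℚ a ℚ.+ ℤtoℚ b
ℤtoℚ-homo-+ a b rewrite ℤtoℚ≡fromℤ a | ℤtoℚ≡fromℤ b =
  cong ℤtoℚ (sym (cong₂ ℤ._+_ (ℤ.*-identityʳ a) (ℤ.*-identityʳ b)))

fromℤ-homo-neg : ∀ a → fromℤ (ℤ.- a) ≡ ℚ.- fromℤ a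
fromℤ-homo-neg (+ ℕ.zero)  = refl
fromℤ-homo-neg (+ ℕ.suc n) = refl
fromℤ-homo-neg -[1+ n ]    = refl

ℤtoℚ-homo-neg : ∀ a → ℤtoℚ (ℤ.- a) ≡ ℚ.- ℤtoℚ a
ℤtoℚ-homo-neg a rewrite ℤtoℚ≡fromℤ (ℤ.- a) | ℤtoℚ≡fromℤ a = fromℤ-homo-neg a

ℤtoℚ-newSize : ∀ ℓ i d → ℤtoℚ (newSize ℓ i d) ≡ ℕtoℚ ℓ ℚ.+ ℕtoℚ i ℚ.- ℕtoℚ d
ℤtoℚ-newSize ℓ i d = begin
  ℤtoℚ ((+ ℓ ℤ.+ + i) ℤ.- + d)               ≡⟨ ℤtoℚ-homo-+ (+ ℓ ℤ.+ + i) (ℤ.- + d) ⟩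
  ℤtoℚ (+ ℓ ℤ.+ + i) ℚ.+ ℤtoℚ (ℤ.- + d)     ≡⟨ cong₂ ℚ._+_ (ℤtoℚ-homo-+ (+ ℓ) (+ i)) (ℤtoℚ-homo-neg (+ d)) ⟩
  ℕtoℚ ℓ ℚ.+ ℕtoℚ i ℚ.- ℕtoℚ d               ∎
  where open ≡-Reasoning

ℕtoℚ-nonNeg : ∀ n → 0ℚ ℚ.≤ ℕtoℚ n
ℕtoℚ-nonNeg n rewrite ℤtoℚ≡fromℤ (+ n) = nonNegative⁻¹ (fromℤ (+ n))

p≤q⇒0≤q-p : ∀ {p q} → p ℚ.≤ q → 0ℚ ℚ.≤ q ℚ.- p
p≤q⇒0≤q-p {p} {q} p≤q = subst (ℚ._≤ q ℚ.- p) (+-inverseʳ p) (+-monoˡ-≤ (ℚ.- p) p≤q)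

0≤q⇒p≤p+q : ∀ {p q} → 0ℚ ℚ.≤ q → p ℚ.≤ p ℚ.+ q
0≤q⇒p≤p+q {p} {q} 0≤q = subst (ℚ._≤ p ℚ.+ q) (+-identityʳ p) (+-monoʳ-≤ p 0≤q)

cost-decomposition : ∀ b l m i d → (1ℚ ℚ.- b) ℚ.* (i ℚ.+ d) ≡
  (b ℚ.* l ℚ.- m) ℚ.+ ((m ℚ.+ i ℚ.- b ℚ.* (l ℚ.+ i ℚ.- d)) ℚ.+ (1ℚ ℚ.- (b ℚ.+ b)) ℚ.* d)
cost-decomposition = solve 5 (λ b l m i d → (con 1ℚ :- b) :* (i :+ d) :=
  (b :* l :- m) :+ ((m :+ i :- b :* (l :+ i :- d)) :+ (con 1ℚ :- (b :+ b)) :* d)) refl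
  where open +-*-Solver

feasible⇒cost-bound : ∀ b l m i d → b ℚ.≤ ½ → 0ℚ ℚ.≤ d →
  b ℚ.* (l ℚ.+ i ℚ.- d) ℚ.< m ℚ.+ i →
  b ℚ.* l ℚ.- m ℚ.≤ (1ℚ ℚ.- b) ℚ.* (i ℚ.+ d)
feasible⇒cost-bound b l m i d b≤½ 0≤d feasible =
  subst (b ℚ.* l ℚ.- m ℚ.≤_) (sym (cost-decomposition b l m i d))
    (0≤q⇒p≤p+q (+-mono-≤ slack≥0 deletions≥0))
  where
  slack≥0 : 0ℚ ℚ.≤ m ℚ.+ i ℚ.- b ℚ.* (l ℚ.+ i ℚ.- d)
  slack≥0 = p≤q⇒0≤q-p (<⇒≤ feasible)
  1-2b≥0 : 0ℚ ℚ.≤ 1ℚ ℚ.- (b ℚ.+ b)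
  1-2b≥0 = p≤q⇒0≤q-p (+-mono-≤ b≤½ b≤½)
  deletions≥0 : 0ℚ ℚ.≤ (1ℚ ℚ.- (b ℚ.+ b)) ℚ.* d
  deletions≥0 = subst (ℚ._≤ (1ℚ ℚ.- (b ℚ.+ b)) ℚ.* d) (*-zeroˡ d)
    (*-monoʳ-≤-nonNeg d {{ℚ.nonNegative 0≤d}} 1-2b≥0)

lemma6 : (ℓ m : ℕ) (β : ℚ) (g : ℕ) →
    0 ℕ.< ℓ → m ℕ.< ℓ → 0ℚ ℚ.< β → β ℚ.≤ ½ →
    ℕ.suc (2 ℕ.* m) ℕ.≤ ℓ →
    IsGamma ℓ m β g →
    (β ℚ.* ℕtoℚ ℓ) ℚ.- ℕtoℚ m ℚ.≤ (1ℚ ℚ.- β) ℚ.* ℕtoℚ g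
lemma6 ℓ m β g _ _ _ β≤½ _ ((ni , nd , (_ , feasible) , refl) , _) =
  subst (λ x → β ℚ.* ℕtoℚ ℓ ℚ.- ℕtoℚ m ℚ.≤ (1ℚ ℚ.- β) ℚ.* x) (sym (ℤtoℚ-homo-+ (+ ni) (+ nd)))
    (feasible⇒cost-bound β (ℕtoℚ ℓ) (ℕtoℚ m) (ℕtoℚ ni) (ℕtoℚ nd) β≤½ (ℕtoℚ-nonNeg nd) feasibleℚ)
  where
  feasibleℚ : β ℚ.* (ℕtoℚ ℓ ℚ.+ ℕtoℚ ni ℚ.- ℕtoℚ nd) ℚ.< ℕtoℚ m ℚ.+ ℕtoℚ ni
  feasibleℚ = subst₂ (λ x y → β ℚ.* x ℚ.< y)
    (ℤtoℚ-newSize ℓ ni nd) (ℤtoℚ-homo-+ (+ m) (+ ni)) feasible
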